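{- Consider the colorability saturation game with $k=4$ colors on a vertex set $V$ of $n$ vertices. Suppose that at some time $t_i$ Mini has just played the $t_i$-th edge, and that pairwise disjoint sets $V_1,\dots,V_i\subseteq V$ have been designated, each inducing a complete graph in $G(t_i)$. Let $W(i):=V\setminus\bigcup_{j\le i}V_j$ and $\phi(i):=|E_{t_i}[W(i)]|+|E_{t_i}[W(i),V\setminus W(i)]|$. Assume $\phi(i) \le 3$, $|W(i)| \ge 4$, and at most one edge of $E_{t_i}[W(i)]$ is isolated in $G(t_i)$. Then Maxi has a strategy for her subsequent moves such that, against every play of Mini, there exist a time $t_{i+1}$ with $t_i\le t_{i+1} \le t_i+6$ at which Mini plays the $t_{i+1}$-th edge (in particular, the game has not ended before), and a set $V_{i+1}\subseteq W(i)$ with $|V_{i+1}|=3$ inducing a complete graph in $G(t_{i+1})$, such that, with $W(i+1):=W(i)\setminus V_{i+1}$, we have $\phi(i+1):=|E_{t_{i+1}}[W(i+1)]|+|E_{t_{i+1}}[W(i+1),V\setminus W(i+1)]| \le 3$.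
   Context: The colorability saturation game with parameters $k,n$: two players, Maxi and Mini, start with the empty graph on vertex set $V$ with $|V|=n$ and take turns, each turn adding one edge not yet present, subject to the constraint that the current graph stays $k$-colorable; the game ends when the graph is saturated, i.e., no further edge can be added while keeping it $k$-colorable. $G(t)=(V,E_t)$ is the graph after $t$ edges have been played in total. $E_t[A]$ is the set of edges of $G(t)$ with both endpoints in $A$, and $E_t[A,B]$ the set of edges of $G(t)$ with one endpoint in $A$ and the other in $B$. An edge is isolated in a graph if both its endpoints have degree $1$. -}

module Defs where

open import Data.Nat using (ℕ; zero; suc; _≡ᵇ_; _≤_)
open import Data.Bool using (Bool; true; false; _∧_; _∨_; not; if_then_else_)
open import Data.Fin using (Fin)
open import Data.Fin.Subset using (Subset; _∈_; _⊆_; _∩_; ∁; ⋃; _─_; ∣_∣; Empty)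
open import Data.Vec using (lookup)
open import Data.List using (List; []; _∷_; _++_; [_]; length; filterᵇ)
open import Data.List.Membership.Propositional using () renaming (_∈_ to _∈ᴸ_)
open import Data.List.Relation.Unary.AllPairs using (AllPairs)
open import Data.Product using (Σ; _×_; _,_; ∃)
open import Data.Sum using (_⊎_)
open import Relation.Nullary using (¬_)
open import Relation.Binary.PropositionalEquality using (_≡_; _≢_)

-- Vertex set V = Fin n.  An edge {u,v} is recorded as an (ordered) pair.
Edge : ℕ → Set
Edge n = Fin n × Fin n

-- A history: the list of edges played so far, in chronological order
-- (the t-th element is the t-th edge).  G(t) is the graph whose edge set
-- is the set of edges occurring in the history of length t.
History : ℕ → Set
History n = List (Edge n)

module _ {n : ℕ} where

  Adj : History n → Fin n → Fin n → Set
  Adj h u v = ((u , v) ∈ᴸ h) ⊎ ((v , u) ∈ᴸ h)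

  Colorable : ℕ → History n → Set
  Colorable k h = Σ (Fin n → Fin k) λ c → ∀ u v → Adj h u v → c u ≢ c v

  Legal : ℕ → History n → Edge n → Set
  Legal k h (u , v) = (u ≢ v) × (¬ Adj h u v) × Colorable k (h ++ [ (u , v) ])

  Saturated : ℕ → History n → Set
  Saturated k h = ∀ e → ¬ Legal k h e

  data LegalPlay (k : ℕ) : History n → Set where
    start : LegalPlay k []
    step  : ∀ {h e} → LegalPlay k h → Legal k h e → LegalPlay k (h ++ [ e ])

  -- Forces k P r h : it is Maxi's turn at position h
  -- (Mini has just moved), and Maxi has a strategy such that, against every
  -- play of Mini, after at most r further rounds (Maxi move + Mini move,
  -- i.e. at most 2r further edges) a position right after a Mini move (or h
  -- itself) is reached where P holds.  In each round Maxi plays a legal edge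
  -- after which the game has not ended, so Mini indeed plays.
  Forces : ℕ → (History n → Set) → ℕ → History n → Set
  Forces k P zero    h = P h
  Forces k P (suc r) h =
    P h ⊎ Σ (Edge n) λ e → Legal k h e × (¬ Saturated k (h ++ [ e ])) ×
            (∀ f → Legal k (h ++ [ e ]) f → Forces k P r ((h ++ [ e ]) ++ [ f ]))

  Clique : History n → Subset n → Set
  Clique h A = ∀ u v → u ∈ A → v ∈ A → u ≢ v → Adj h u v

  mem : Subset n → Fin n → Bool
  mem A u = lookup A u

  eIn : History n → Subset n → ℕ
  eIn h A = length (filterᵇ (λ { (u , v) → mem A u ∧ mem A v }) h)

  eOut : History n → Subset n → ℕ
  eOut h A = length (filterᵇ (λ { (u , v) → (mem A u ∧ not (mem A v)) ∨ (not (mem A u) ∧ mem A v) }) h)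

  phi : History n → Subset n → ℕ
  phi h W = eIn h W + eOut h W
    where open import Data.Nat using (_+_)

  deg : History n → Fin n → ℕ
  deg h u = length (filterᵇ (λ { (a , b) → isU a ∨ isU b }) h)
    where
      open import Data.Fin using (_≟_)
      open import Relation.Nullary using (does)
      isU : Fin n → Bool
      isU x = does (x ≟ u)

  isolatedIn : History n → Subset n → ℕ
  isolatedIn h W = length (filterᵇ (λ { (u , v) → mem W u ∧ mem W v ∧ (deg h u ≡ᵇ 1) ∧ (deg h v ≡ᵇ 1) }) h)

  Disjoint : Subset n → Subset n → Set
  Disjoint A B = Empty (A ∩ B)

  Wof : List (Subset n) → Subset n
  Wof Vs = ∁ (⋃ Vs)

  NextStage : Subset n → History n → Set
  NextStage W h = Σ (Subset n) λ V' → (V' ⊆ W) × (∣ V' ∣ ≡ 3) × Clique h V' × (phi h (W ─ V') ≤ 3)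

-- Choose three vertices a, b, c ∈ W and a spare vertex d ∈ W ∖ {a,b,c} so that the number of edges
-- touching W ∖ {a,b,c} plus the number of missing sides of the triangle abc is at most 3; φ ≤ 3 leaves
-- at most three edges touching W, and the isolated-edge condition rules out the one configuration
-- (two disjoint edges inside W, far from everything else) where no such choice exists.
-- Maxi then adds a missing side in every round.  At most five edges leave {a,b,c}, so the colours
-- forbidden to a, b, c at any moment admit distinct representatives among four colours: abc can be
-- recoloured rainbow, making the side legal.  Afterwards d sees at most two colours, so d can still be
-- joined to a corner and the game is not over.  Mini's reply adds at most one edge touching
-- W ∖ {a,b,c} while Maxi removed a missing side, so the sum stays ≤ 3, and after at most three rounds
-- abc is a triangle with φ(W ∖ {a,b,c}) ≤ 3.

module Submission where

open import Defs
open import Data.Bool using (Bool; true; false; _∧_; _∨_; not; _xor_; if_then_else_)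
open import Data.Bool.Properties using (∨-zeroʳ; T-≡)
open import Data.Empty as Empty using (⊥-elim)
open import Data.Fin using (Fin; _≟_) renaming (zero to fzero; suc to fsuc)
open import Data.Fin.Properties using (any?)
open import Data.Fin.Subset using (Subset; _∈_; _∉_; _⊆_; _∪_; _─_; ⁅_⁆; ⊥; ⊤; ∣_∣)
open import Data.Fin.Subset.Properties
  using (_∈?_; ∉⊥; ∈⊤; x∈⁅x⁆; x∈⁅y⁆⇒x≡y; x≢y⇒x∉⁅y⁆; x∈p∪q⁺; x∈p∪q⁻; ∪-identityˡ; p─q⊆p; x∈p∧x∉q⇒x∈p─q;
         ∣⊥∣≡0; ∣⊤∣≡n; ∣⁅x⁆∣≡1; ∣p∣≤n; ∣p∣≡n⇒p≡⊤; p⊆q⇒∣p∣≤∣q∣)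
open import Data.List using (List; []; _∷_; _++_; [_]; length; filterᵇ; map)
open import Data.List.Properties using (length-++; filter-++; length-map; length-filter)
open import Data.List.Membership.Propositional using (find) renaming (_∈_ to _∈ᴸ_; _∉_ to _∉ᴸ_)
open import Data.List.Membership.Propositional.Properties
  using (∈-++⁺ˡ; ∈-++⁺ʳ; ∈-++⁻; ∈-map⁺; ∈-map⁻; ∈-filter⁺; ∈-filter⁻)
import Data.List.Membership.DecPropositional as DecMembership
open import Data.List.Relation.Unary.Any using (here; there)
open import Data.List.Relation.Unary.All using (All; []; _∷_; all?)
import Data.List.Relation.Unary.All as All
open import Data.List.Relation.Unary.All.Properties using (¬All⇒Any¬)
open import Data.List.Relation.Unary.AllPairs using (AllPairs; []; _∷_)
open import Data.List.Relation.Binary.Permutation.Propositional using (_↭_; ↭-refl; ↭-sym; ↭-trans; prep; swap)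
open import Data.List.Relation.Binary.Permutation.Propositional.Properties using (↭-length; filter-↭; ∈-resp-↭)
open import Data.Nat using (ℕ; zero; suc; _+_; _≤_; _<_; z≤n; s≤s; _≡ᵇ_)
open import Data.Nat.Properties hiding (_≟_)
open import Algebra.Properties.CommutativeSemigroup +-commutativeSemigroup using (interchange)
open import Data.Product using (Σ; _×_; _,_; proj₁; proj₂; ∃)
open import Data.Product.Properties using (≡-dec)
open import Data.Sum using (_⊎_; inj₁; inj₂; [_,_]′)
open import Data.Vec using ([]; _∷_) renaming (here to vhere; there to vthere)
open import Data.Vec.Properties using (lookup⇒[]=; []=⇒lookup)
open import Function using (_∘_; case_of_)
open import Function.Bundles using (Equivalence)
open import Relation.Nullary using (¬_; Dec; yes; no; does)
open import Relation.Nullary.Decidable using (T?; ¬?; _×-dec_; _⊎-dec_; dec-true; dec-false)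
open import Relation.Binary.PropositionalEquality hiding ([_])

𝟙 : Bool → ℕ
𝟙 true = 1
𝟙 false = 0

𝟙≤1 : ∀ b → 𝟙 b ≤ 1
𝟙≤1 true = ≤-refl
𝟙≤1 false = z≤n

𝟙-mono : ∀ {b c} → (b ≡ true → c ≡ true) → 𝟙 b ≤ 𝟙 c
𝟙-mono {false} _ = z≤n
𝟙-mono {true} b⇒c rewrite b⇒c refl = ≤-refl

𝟙-∨ : ∀ {b c} → (b ≡ true → c ≡ false) → 𝟙 b + 𝟙 c ≡ 𝟙 (b ∨ c)
𝟙-∨ {false} _ = refl
𝟙-∨ {true} b⇒¬c rewrite b⇒¬c refl = refl

∨-true⁻ : ∀ b {c} → (b ∨ c) ≡ true → b ≡ true ⊎ c ≡ true
∨-true⁻ true _ = inj₁ refl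
∨-true⁻ false c≡true = inj₂ c≡true

⇒-false : ∀ {b c} → (b ≡ true → c ≡ true) → c ≡ false → b ≡ false
⇒-false {false} _ _ = refl
⇒-false {true} b⇒c refl with () ← b⇒c refl

module _ {A : Set} where

  count : (A → Bool) → List A → ℕ
  count p xs = length (filterᵇ p xs)

  count-∷ : ∀ p x xs → count p (x ∷ xs) ≡ 𝟙 (p x) + count p xs
  count-∷ p x xs with p x
  ... | true = refl
  ... | false = refl

  count-++ : ∀ p xs ys → count p (xs ++ ys) ≡ count p xs + count p ys
  count-++ p xs ys = trans (cong length (filter-++ (T? ∘ p) xs ys)) (length-++ (filterᵇ p xs))

  count-∷ʳ : ∀ p xs x → count p (xs ++ [ x ]) ≡ count p xs + 𝟙 (p x)
  count-∷ʳ p xs x =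
    trans (count-++ p xs [ x ]) (cong (count p xs +_) (trans (count-∷ p x []) (+-identityʳ (𝟙 (p x)))))

  count-∷ʳ≤ : ∀ p xs x → count p (xs ++ [ x ]) ≤ count p xs + 1
  count-∷ʳ≤ p xs x = ≤-trans (≤-reflexive (count-∷ʳ p xs x)) (+-monoʳ-≤ (count p xs) (𝟙≤1 (p x)))

  count≤length : ∀ p xs → count p xs ≤ length xs
  count≤length p = length-filter (T? ∘ p)

  count-↭ : ∀ p {xs ys} → xs ↭ ys → count p xs ≡ count p ys
  count-↭ p xs↭ys = ↭-length (filter-↭ (T? ∘ p) xs↭ys)

  count-mono : ∀ {p q} → (∀ x → p x ≡ true → q x ≡ true) → ∀ xs → count p xs ≤ count q xs
  count-mono p⇒q [] = z≤n
  count-mono {p} {q} p⇒q (x ∷ xs) rewrite count-∷ p x xs | count-∷ q x xs =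
    +-mono-≤ (𝟙-mono (p⇒q x)) (count-mono p⇒q xs)

  count-< : ∀ {p q x xs} → (∀ y → p y ≡ true → q y ≡ true) →
            x ∈ᴸ xs → p x ≡ false → q x ≡ true → count p xs < count q xs
  count-< {p} {q} {xs = y ∷ xs} p⇒q (here refl) px qx rewrite count-∷ p y xs | count-∷ q y xs | px | qx =
    s≤s (count-mono p⇒q xs)
  count-< {p} {q} {xs = y ∷ xs} p⇒q (there x∈xs) px qx rewrite count-∷ p y xs | count-∷ q y xs =
    +-mono-≤-< (𝟙-mono (p⇒q y)) (count-< p⇒q x∈xs px qx)

  count-pos : ∀ {p x xs} → x ∈ᴸ xs → p x ≡ true → 0 < count p xs
  count-pos {p} {xs = y ∷ xs} (here refl) px rewrite count-∷ p y xs | px = s≤s z≤n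
  count-pos {p} {xs = y ∷ xs} (there x∈xs) px rewrite count-∷ p y xs =
    ≤-trans (count-pos x∈xs px) (m≤n+m _ (𝟙 (p y)))

  count-none : ∀ {p xs} → All (λ x → p x ≡ false) xs → count p xs ≡ 0
  count-none [] = refl
  count-none {p} {x ∷ xs} (px ∷ pxs) rewrite count-∷ p x xs | px = count-none pxs

  count-filter : ∀ {p q} → (∀ x → p x ≡ true → q x ≡ true) → ∀ xs → count p (filterᵇ q xs) ≡ count p xs
  count-filter p⇒q [] = refl
  count-filter {p} {q} p⇒q (x ∷ xs) with q x in qx
  ... | true rewrite count-∷ p x (filterᵇ q xs) | count-∷ p x xs = cong (𝟙 (p x) +_) (count-filter p⇒q xs)
  ... | false rewrite count-∷ p x xs | ⇒-false (p⇒q x) qx = count-filter p⇒q xs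

  count-∨ : ∀ {p q} → (∀ x → p x ≡ true → q x ≡ false) → ∀ xs →
            count p xs + count q xs ≡ count (λ x → p x ∨ q x) xs
  count-∨ disj [] = refl
  count-∨ {p} {q} disj (x ∷ xs) rewrite count-∷ p x xs | count-∷ q x xs | count-∷ (λ y → p y ∨ q y) x xs =
    trans (interchange (𝟙 (p x)) (count p xs) (𝟙 (q x)) (count q xs))
          (cong₂ _+_ (𝟙-∨ (disj x)) (count-∨ disj xs))

∣p∪q∣≤∣p∣+∣q∣ : ∀ {m} (p q : Subset m) → ∣ p ∪ q ∣ ≤ ∣ p ∣ + ∣ q ∣
∣p∪q∣≤∣p∣+∣q∣ [] [] = z≤n
∣p∪q∣≤∣p∣+∣q∣ (true ∷ p) (true ∷ q) = s≤s (≤-trans (∣p∪q∣≤∣p∣+∣q∣ p q) (+-monoʳ-≤ ∣ p ∣ (n≤1+n _)))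
∣p∪q∣≤∣p∣+∣q∣ (true ∷ p) (false ∷ q) = s≤s (∣p∪q∣≤∣p∣+∣q∣ p q)
∣p∪q∣≤∣p∣+∣q∣ (false ∷ p) (true ∷ q) = ≤-trans (s≤s (∣p∪q∣≤∣p∣+∣q∣ p q)) (≤-reflexive (sym (+-suc _ _)))
∣p∪q∣≤∣p∣+∣q∣ (false ∷ p) (false ∷ q) = ∣p∪q∣≤∣p∣+∣q∣ p q

∣⁅x⁆∪p∣≡1+∣p∣ : ∀ {m} (x : Fin m) (p : Subset m) → x ∉ p → ∣ ⁅ x ⁆ ∪ p ∣ ≡ suc ∣ p ∣
∣⁅x⁆∪p∣≡1+∣p∣ fzero (true ∷ p) x∉p = ⊥-elim (x∉p vhere)
∣⁅x⁆∪p∣≡1+∣p∣ fzero (false ∷ p) _ = cong (suc ∘ ∣_∣) (∪-identityˡ p)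
∣⁅x⁆∪p∣≡1+∣p∣ (fsuc x) (true ∷ p) x∉p = cong suc (∣⁅x⁆∪p∣≡1+∣p∣ x p (x∉p ∘ vthere))
∣⁅x⁆∪p∣≡1+∣p∣ (fsuc x) (false ∷ p) x∉p = ∣⁅x⁆∪p∣≡1+∣p∣ x p (x∉p ∘ vthere)

_∈ᴸ?_ : ∀ {m} (x : Fin m) is → Dec (x ∈ᴸ is)
x ∈ᴸ? is = DecMembership._∈?_ _≟_ x is

x∈q⇒x∉p─q : ∀ {m} {x : Fin m} (p q : Subset m) → x ∈ q → x ∉ p ─ q
x∈q⇒x∉p─q (s ∷ p) (.true ∷ q) vhere ()
x∈q⇒x∉p─q (s ∷ p) (t ∷ q) (vthere x∈q) (vthere x∈p─q) = x∈q⇒x∉p─q p q x∈q x∈p─q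

module _ {m : ℕ} where

  fromList : List (Fin m) → Subset m
  fromList [] = ⊥
  fromList (i ∷ is) = ⁅ i ⁆ ∪ fromList is

  ∈fromList⁺ : ∀ {i is} → i ∈ᴸ is → i ∈ fromList is
  ∈fromList⁺ (here refl) = x∈p∪q⁺ (inj₁ (x∈⁅x⁆ _))
  ∈fromList⁺ (there i∈is) = x∈p∪q⁺ (inj₂ (∈fromList⁺ i∈is))

  ∈fromList⁻ : ∀ {i} is → i ∈ fromList is → i ∈ᴸ is
  ∈fromList⁻ [] i∈ = ⊥-elim (∉⊥ i∈)
  ∈fromList⁻ (j ∷ is) i∈ with x∈p∪q⁻ ⁅ j ⁆ (fromList is) i∈
  ... | inj₁ i∈⁅j⁆ = here (x∈⁅y⁆⇒x≡y j i∈⁅j⁆)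
  ... | inj₂ i∈is = there (∈fromList⁻ is i∈is)

  ∣fromList∣≤length : ∀ is → ∣ fromList is ∣ ≤ length is
  ∣fromList∣≤length [] = ≤-reflexive (∣⊥∣≡0 m)
  ∣fromList∣≤length (i ∷ is) = begin
    ∣ ⁅ i ⁆ ∪ fromList is ∣        ≤⟨ ∣p∪q∣≤∣p∣+∣q∣ ⁅ i ⁆ (fromList is) ⟩
    ∣ ⁅ i ⁆ ∣ + ∣ fromList is ∣    ≡⟨ cong (_+ ∣ fromList is ∣) (∣⁅x⁆∣≡1 i) ⟩
    suc ∣ fromList is ∣            ≤⟨ s≤s (∣fromList∣≤length is) ⟩
    suc (length is)                ∎
    where open ≤-Reasoning

  ∣fromList∣≡length : ∀ {is} → AllPairs _≢_ is → ∣ fromList is ∣ ≡ length is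
  ∣fromList∣≡length [] = ∣⊥∣≡0 m
  ∣fromList∣≡length {i ∷ is} (i≢is ∷ distinct) =
    trans (∣⁅x⁆∪p∣≡1+∣p∣ i (fromList is) (λ i∈ → All.lookup i≢is (∈fromList⁻ is i∈) refl))
          (cong suc (∣fromList∣≡length distinct))

  fromList⊆ : ∀ {is p} → All (_∈ p) is → fromList is ⊆ p
  fromList⊆ {is} all i∈ = All.lookup all (∈fromList⁻ is i∈)

∣p∣<n⇒∃∉ : ∀ {m} (p : Subset m) → ∣ p ∣ < m → ∃ λ x → x ∉ p
∣p∣<n⇒∃∉ {m} p ∣p∣<m with any? (λ x → ¬? (x ∈? p))
... | yes found = found
... | no none = ⊥-elim (<⇒≱ ∣p∣<m (subst (_≤ ∣ p ∣) (∣⊤∣≡n m) (p⊆q⇒∣p∣≤∣q∣ ⊤⊆p)))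
  where
    ⊤⊆p : ⊤ ⊆ p
    ⊤⊆p {x} _ with x ∈? p
    ... | yes x∈p = x∈p
    ... | no x∉p = ⊥-elim (none (x , x∉p))

x∉p⇒∣p∣<n : ∀ {m x} (p : Subset m) → x ∉ p → ∣ p ∣ < m
x∉p⇒∣p∣<n {x = x} p x∉p = ≤∧≢⇒< (∣p∣≤n p) (λ ∣p∣≡m → x∉p (subst (x ∈_) (sym (∣p∣≡n⇒p≡⊤ ∣p∣≡m)) ∈⊤))

∃∉∧∉ᴸ : ∀ {m} (p : Subset m) is → ∣ p ∣ + length is < m → ∃ λ x → x ∉ p × x ∉ᴸ is
∃∉∧∉ᴸ p is bound with ∣p∣<n⇒∃∉ (p ∪ fromList is) (≤-<-trans (∣p∪q∣≤∣p∣+∣q∣ p (fromList is))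
                                                   (≤-<-trans (+-monoʳ-≤ ∣ p ∣ (∣fromList∣≤length is)) bound))
... | x , x∉ = x , x∉ ∘ x∈p∪q⁺ ∘ inj₁ , x∉ ∘ x∈p∪q⁺ ∘ inj₂ ∘ ∈fromList⁺

∃∈∧∉ᴸ : ∀ {m} (p : Subset m) is → length is < ∣ p ∣ → ∃ λ x → x ∈ p × x ∉ᴸ is
∃∈∧∉ᴸ p is bound with any? (λ x → x ∈? p ×-dec ¬? (x ∈ᴸ? is))
... | yes found = found
... | no none = ⊥-elim (<⇒≱ bound (≤-trans (p⊆q⇒∣p∣≤∣q∣ p⊆is) (∣fromList∣≤length is)))
  where
    p⊆is : p ⊆ fromList is
    p⊆is {x} x∈p with x ∈ᴸ? is
    ... | yes x∈is = ∈fromList⁺ x∈is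
    ... | no x∉is = ⊥-elim (none (x , x∈p , x∉is))

Distinct3 : {A : Set} → A → A → A → Set
Distinct3 x y z = x ≢ y × y ≢ z × x ≢ z

Distinct3⇒AllPairs : ∀ {A : Set} {x y z : A} → Distinct3 x y z → AllPairs _≢_ (x ∷ y ∷ z ∷ [])
Distinct3⇒AllPairs (x≢y , y≢z , x≢z) = (x≢y ∷ x≢z ∷ []) ∷ (y≢z ∷ []) ∷ [] ∷ []

one-of-three-∉ : ∀ {m} {x y z : Fin m} (p : Subset m) → ∣ p ∣ ≤ 2 → Distinct3 x y z → x ∉ p ⊎ y ∉ p ⊎ z ∉ p
one-of-three-∉ {x = x} {y} {z} p ∣p∣≤2 distinct with x ∈? p | y ∈? p | z ∈? p
... | no x∉p | _ | _ = inj₁ x∉p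
... | yes _ | no y∉p | _ = inj₂ (inj₁ y∉p)
... | yes _ | yes _ | no z∉p = inj₂ (inj₂ z∉p)
... | yes x∈p | yes y∈p | yes z∈p = ⊥-elim (<⇒≱ (s≤s ∣p∣≤2) (begin
  3                               ≡⟨ sym (∣fromList∣≡length (Distinct3⇒AllPairs distinct)) ⟩
  ∣ fromList (x ∷ y ∷ z ∷ []) ∣   ≤⟨ p⊆q⇒∣p∣≤∣q∣ (fromList⊆ (x∈p ∷ y∈p ∷ z∈p ∷ [])) ⟩
  ∣ p ∣                           ∎))
  where open ≤-Reasoning

-- Three distinct colours avoiding three forbidden sets

DistinctAvoiders : Subset 4 → Subset 4 → Subset 4 → Set
DistinctAvoiders F G H =
  Σ (Fin 4) λ α → Σ (Fin 4) λ β → Σ (Fin 4) λ γ → (α ∉ F × β ∉ G × γ ∉ H) × Distinct3 α β γ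

swap₁₂ : ∀ {F G H} → DistinctAvoiders F G H → DistinctAvoiders G F H
swap₁₂ (α , β , γ , (α∉F , β∉G , γ∉H) , (α≢β , β≢γ , α≢γ)) =
  β , α , γ , (β∉G , α∉F , γ∉H) , (≢-sym α≢β , α≢γ , β≢γ)

swap₂₃ : ∀ {F G H} → DistinctAvoiders F G H → DistinctAvoiders F H G
swap₂₃ (α , β , γ , (α∉F , β∉G , γ∉H) , (α≢β , β≢γ , α≢γ)) =
  α , γ , β , (α∉F , γ∉H , β∉G) , (α≢γ , ≢-sym β≢γ , α≢β)

greedy : ∀ F G H → ∣ F ∣ ≤ 3 → ∣ G ∣ ≤ 2 → ∣ H ∣ ≤ 1 → DistinctAvoiders F G H
greedy F G H ∣F∣≤3 ∣G∣≤2 ∣H∣≤1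
  with α , α∉F ← ∣p∣<n⇒∃∉ F (s≤s ∣F∣≤3)
  with β , β∉G , β∉α ← ∃∉∧∉ᴸ G [ α ] (s≤s (+-monoˡ-≤ 1 ∣G∣≤2))
  with γ , γ∉H , γ∉αβ ← ∃∉∧∉ᴸ H (α ∷ β ∷ []) (s≤s (+-monoˡ-≤ 2 ∣H∣≤1)) =
  α , β , γ , (α∉F , β∉G , γ∉H) ,
  (β∉α ∘ here ∘ sym , γ∉αβ ∘ there ∘ here ∘ sym , γ∉αβ ∘ here ∘ sym)

greedy-last : ∀ F G H → ∣ F ∣ ≤ 3 → ∣ G ∣ ≤ 3 → ∣ F ∣ + ∣ G ∣ ≤ 5 → ∣ H ∣ ≤ 1 → DistinctAvoiders F G H
greedy-last F G H ∣F∣≤3 ∣G∣≤3 sum ∣H∣≤1 with ∣ G ∣ ≤? 2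
... | yes ∣G∣≤2 = greedy F G H ∣F∣≤3 ∣G∣≤2 ∣H∣≤1
... | no ∣G∣≰2 = swap₁₂ (greedy G F H ∣G∣≤3 ∣F∣≤2 ∣H∣≤1)
  where
    ∣F∣≤2 : ∣ F ∣ ≤ 2
    ∣F∣≤2 = +-cancelʳ-≤ 3 ∣ F ∣ 2 (≤-trans (+-monoʳ-≤ ∣ F ∣ (≰⇒> ∣G∣≰2)) sum)

-- Some set has size ≤ 1 and one of the other two size ≤ 2, so the greedy choice works after sorting.
distinctAvoiders : ∀ F G H → ∣ F ∣ ≤ 3 → ∣ G ∣ ≤ 3 → ∣ H ∣ ≤ 3 → ∣ F ∣ + ∣ G ∣ + ∣ H ∣ ≤ 5 →
  DistinctAvoiders F G H
distinctAvoiders F G H ∣F∣≤3 ∣G∣≤3 ∣H∣≤3 sum with ∣ H ∣ ≤? 1 | ∣ G ∣ ≤? 1 | ∣ F ∣ ≤? 1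
... | yes ∣H∣≤1 | _ | _ = greedy-last F G H ∣F∣≤3 ∣G∣≤3 (m+n≤o⇒m≤o _ sum) ∣H∣≤1
... | no _ | yes ∣G∣≤1 | _ =
  swap₂₃ (greedy-last F H G ∣F∣≤3 ∣H∣≤3 (≤-trans (+-monoˡ-≤ ∣ H ∣ (m≤m+n ∣ F ∣ ∣ G ∣)) sum) ∣G∣≤1)
... | no _ | no _ | yes ∣F∣≤1 =
  swap₁₂ (swap₂₃ (greedy-last G H F ∣G∣≤3 ∣H∣≤3 (≤-trans (+-monoˡ-≤ ∣ H ∣ (m≤n+m ∣ G ∣ ∣ F ∣)) sum) ∣F∣≤1))
... | no ∣H∣≰1 | no ∣G∣≰1 | no ∣F∣≰1 =
  ⊥-elim (<⇒≱ (s≤s sum) (+-mono-≤ (+-mono-≤ (≰⇒> ∣F∣≰1) (≰⇒> ∣G∣≰1)) (≰⇒> ∣H∣≰1)))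

module _ {n : ℕ} where

  private variable
    k : ℕ
    h : History n
    u v x y : Fin n

  touches : Subset n → Edge n → Bool
  touches A (u , v) = mem A u ∨ mem A v

  crosses : Subset n → Edge n → Bool
  crosses A (u , v) = mem A u xor mem A v

  incident : Fin n → Edge n → Bool
  incident x (u , v) = does (u ≟ x) ∨ does (v ≟ x)

  phi≡count-touches : ∀ h A → phi h A ≡ count (touches A) h
  phi≡count-touches [] A = refl
  phi≡count-touches ((u , v) ∷ h) A with mem A u | mem A v | phi≡count-touches h A
  ... | true  | true  | ih = cong suc ih
  ... | true  | false | ih = trans (+-suc _ _) (cong suc ih)
  ... | false | true  | ih = trans (+-suc _ _) (cong suc ih)
  ... | false | false | ih = ih

  touches-⊆ : ∀ {A B} → A ⊆ B → ∀ e → touches A e ≡ true → touches B e ≡ true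
  touches-⊆ {A} {B} A⊆B (u , v) t with mem A u in Au | mem A v in Av
  ... | true  | _    rewrite []=⇒lookup (A⊆B (lookup⇒[]= u A Au)) = refl
  ... | false | true rewrite []=⇒lookup (A⊆B (lookup⇒[]= v A Av)) = ∨-zeroʳ _

  crosses⇒touches : ∀ A e → crosses A e ≡ true → touches A e ≡ true
  crosses⇒touches A (u , v) with mem A u | mem A v
  ... | true  | _    = λ _ → refl
  ... | false | true = λ _ → refl

  incident⇒touches : ∀ {A} → x ∈ A → ∀ e → incident x e ≡ true → touches A e ≡ true
  incident⇒touches {x = x} {A} x∈A (u , v) on with u ≟ x | v ≟ x
  ... | yes refl | _ rewrite []=⇒lookup x∈A = refl
  ... | no _ | yes refl rewrite []=⇒lookup x∈A = ∨-zeroʳ _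

  Adj-sym : Adj h u v → Adj h v u
  Adj-sym (inj₁ uv∈h) = inj₂ uv∈h
  Adj-sym (inj₂ vu∈h) = inj₁ vu∈h

  Adj-++ : ∀ xs → Adj h u v → Adj (h ++ xs) u v
  Adj-++ xs (inj₁ uv∈h) = inj₁ (∈-++⁺ˡ uv∈h)
  Adj-++ xs (inj₂ vu∈h) = inj₂ (∈-++⁺ˡ vu∈h)

  Adj-∷ʳ⁻ : Adj (h ++ [ (x , y) ]) u v → Adj h u v ⊎ (u ≡ x × v ≡ y) ⊎ (u ≡ y × v ≡ x)
  Adj-∷ʳ⁻ {h = h} (inj₁ uv∈) with ∈-++⁻ h uv∈
  ... | inj₁ uv∈h = inj₁ (inj₁ uv∈h)
  ... | inj₂ (here refl) = inj₂ (inj₁ (refl , refl))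
  Adj-∷ʳ⁻ {h = h} (inj₂ vu∈) with ∈-++⁻ h vu∈
  ... | inj₁ vu∈h = inj₁ (inj₂ vu∈h)
  ... | inj₂ (here refl) = inj₂ (inj₂ (refl , refl))

  adj? : ∀ h u v → Dec (Adj h u v)
  adj? h u v = ((u , v) ∈ᴱ? h) ⊎-dec ((v , u) ∈ᴱ? h)
    where
      _∈ᴱ?_ : ∀ e (h : History n) → Dec (e ∈ᴸ h)
      e ∈ᴱ? h = DecMembership._∈?_ (≡-dec _≟_ _≟_) e h

  Proper : History n → (Fin n → Fin k) → Set
  Proper h col = ∀ u v → Adj h u v → col u ≢ col v

  Proper⇒≢ : {col : Fin n → Fin k} → Proper h col → Adj h u v → u ≢ v
  Proper⇒≢ {u = u} proper uv refl = proper u u uv refl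

  Proper-∷ʳ : {col : Fin n → Fin k} → Proper h col → col x ≢ col y → Proper (h ++ [ (x , y) ]) col
  Proper-∷ʳ {h = h} proper x≁y u v uv = case Adj-∷ʳ⁻ {h = h} uv of λ where
    (inj₁ old) → proper u v old
    (inj₂ (inj₁ (refl , refl))) → x≁y
    (inj₂ (inj₂ (refl , refl))) → ≢-sym x≁y

  LegalPlay⇒Colorable : LegalPlay (suc k) h → Colorable (suc k) h
  LegalPlay⇒Colorable start = (λ _ → fzero) , λ { _ _ (inj₁ ()) ; _ _ (inj₂ ()) }
  LegalPlay⇒Colorable (step _ (_ , _ , colourable)) = colourable

  ∉⇒mem≡false : ∀ {A : Subset n} → x ∉ A → mem A x ≡ false
  ∉⇒mem≡false {x = x} {A} x∉A with mem A x in eq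
  ... | true = ⊥-elim (x∉A (lookup⇒[]= x A eq))
  ... | false = refl

  -- Recolouring

  joins : Subset n → Fin n → Edge n → Bool
  joins S x (u , v) = (does (u ≟ x) ∧ not (mem S v)) ∨ (does (v ≟ x) ∧ not (mem S u))

  other : Fin n → Edge n → Fin n
  other x (u , v) = if does (u ≟ x) then v else u

  outNbrs : Subset n → Fin n → History n → List (Fin n)
  outNbrs S x h = map (other x) (filterᵇ (joins S x) h)

  -- The colours x must avoid when only the vertices of S are recoloured.
  forbidden : (Fin n → Fin k) → Subset n → Fin n → History n → Subset k
  forbidden col S x h = fromList (map col (outNbrs S x h))

  joins⁻ : ∀ S x u v → joins S x (u , v) ≡ true → (u ≡ x × mem S v ≡ false) ⊎ (v ≡ x × mem S u ≡ false)
  joins⁻ S x u v eq with u ≟ x | v ≟ x | mem S u | mem S v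
  ... | yes u≡x | _       | _     | false = inj₁ (u≡x , refl)
  ... | _       | yes v≡x | false | _     = inj₂ (v≡x , refl)
  ... | yes _   | yes _   | true  | true  with () ← eq
  ... | yes _   | no _    | _     | true  with () ← eq
  ... | no _    | yes _   | true  | _     with () ← eq
  ... | no _    | no _    | _     | _     with () ← eq

  other-fst : other x (x , v) ≡ v
  other-fst {x = x} rewrite dec-true (x ≟ x) refl = refl

  other-snd : other x (u , x) ≡ u
  other-snd {x = x} {u} with u ≟ x
  ... | yes refl = refl
  ... | no _ = refl

  joins-fst : ∀ S x → mem S v ≡ false → joins S x (x , v) ≡ true
  joins-fst S x S∌v rewrite dec-true (x ≟ x) refl | S∌v = refl

  joins-snd : ∀ S x → mem S u ≡ false → joins S x (u , x) ≡ true
  joins-snd S x S∌u rewrite dec-true (x ≟ x) refl | S∌u = ∨-zeroʳ _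

  joins⇒Adj : ∀ {S e} → e ∈ᴸ h → joins S x e ≡ true → Adj h x (other x e)
  joins⇒Adj {x = x} {S = S} {e = u , v} e∈h j with joins⁻ S x u v j
  ... | inj₁ (refl , _) rewrite other-fst {x = u} {v} = inj₁ e∈h
  ... | inj₂ (refl , _) rewrite other-snd {x = v} {u} = inj₂ e∈h

  outNbrs⁺ : ∀ {S} → Adj h x y → y ∉ S → y ∈ᴸ outNbrs S x h
  outNbrs⁺ {h = h} {x = x} {y = y} {S = S} xy y∉S = neighbour xy
    where
      via : ∀ {e} → e ∈ᴸ h → joins S x e ≡ true → other x e ≡ y → y ∈ᴸ outNbrs S x h
      via e∈h j refl = ∈-map⁺ (other x) (∈-filter⁺ (T? ∘ joins S x) e∈h (Equivalence.from T-≡ j))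
      neighbour : Adj h x y → y ∈ᴸ outNbrs S x h
      neighbour (inj₁ xy∈h) = via xy∈h (joins-fst S x (∉⇒mem≡false y∉S)) (other-fst {x = x})
      neighbour (inj₂ yx∈h) = via yx∈h (joins-snd S x (∉⇒mem≡false y∉S)) (other-snd {x = x})

  outNbrs⁻ : ∀ {S} → y ∈ᴸ outNbrs S x h → Adj h x y
  outNbrs⁻ {x = x} {S = S} y∈ with ∈-map⁻ (other x) y∈
  ... | e , e∈ , refl with ∈-filter⁻ (T? ∘ joins S x) e∈
  ...   | e∈h , j = joins⇒Adj {S = S} e∈h (Equivalence.to T-≡ j)

  ∣forbidden∣≤count-joins : ∀ (col : Fin n → Fin k) S x h → ∣ forbidden col S x h ∣ ≤ count (joins S x) h
  ∣forbidden∣≤count-joins col S x h =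
    ≤-trans (∣fromList∣≤length (map col (outNbrs S x h)))
      (≤-reflexive (trans (length-map col (outNbrs S x h)) (length-map (other x) (filterᵇ (joins S x) h))))

  forbidden⁺ : ∀ {S} (col : Fin n → Fin k) → Adj h x y → y ∉ S → col y ∈ forbidden col S x h
  forbidden⁺ col xy y∉S = ∈fromList⁺ (∈-map⁺ col (outNbrs⁺ xy y∉S))

  forbidden⁻ : ∀ {S i} (col : Fin n → Fin k) → i ∈ forbidden col S x h → ∃ λ y → Adj h x y × col y ≡ i
  forbidden⁻ {x = x} {h = h} {S = S} col i∈ with ∈-map⁻ col (∈fromList⁻ _ i∈)
  ... | y , y∈ , refl = y , outNbrs⁻ {S = S} y∈ , refl

  colour∉forbidden : ∀ {S} {col : Fin n → Fin k} → Proper h col → col x ∉ forbidden col S x h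
  colour∉forbidden {h = h} {x = x} {S = S} {col = col} proper cx∈
    with y , xy , cy≡cx ← forbidden⁻ {x = x} {h = h} {S = S} col cx∈ = proper x y xy (sym cy≡cx)

  ∣forbidden∣<k : ∀ {col : Fin n → Fin k} S x → Proper h col → ∣ forbidden col S x h ∣ < k
  ∣forbidden∣<k S x proper = x∉p⇒∣p∣<n _ (colour∉forbidden {x = x} {S = S} proper)

  recolour : ∀ {S} {col col′ : Fin n → Fin k} → Proper h col →
    (∀ u → u ∉ S → col′ u ≡ col u) →
    (∀ u → u ∈ S → col′ u ∉ forbidden col S u h) →
    (∀ u v → u ∈ S → v ∈ S → Adj h u v → col′ u ≢ col′ v) →
    Proper h col′
  recolour {h = h} {S} {col} {col′} proper keep avoid within u v uv with u ∈? S | v ∈? S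
  ... | yes u∈S | yes v∈S = within u v u∈S v∈S uv
  ... | yes u∈S | no v∉S = λ eq →
    avoid u u∈S (subst (_∈ forbidden col S u h) (sym (trans eq (keep v v∉S))) (forbidden⁺ col uv v∉S))
  ... | no u∉S | yes v∈S = λ eq →
    avoid v v∈S (subst (_∈ forbidden col S v h) (sym (trans (sym eq) (keep u u∉S)))
                       (forbidden⁺ col (Adj-sym uv) u∉S))
  ... | no u∉S | no v∉S = λ eq → proper u v uv (trans (sym (keep u u∉S)) (trans eq (keep v v∉S)))

  paint : {A : Set} → (Fin n → A) → Fin n → A → Fin n → A
  paint f x a u = if does (u ≟ x) then a else f u

  paint-≡ : ∀ {A : Set} (f : Fin n → A) x a → paint f x a x ≡ a
  paint-≡ f x a rewrite dec-true (x ≟ x) refl = refl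

  paint-≢ : ∀ {A : Set} (f : Fin n → A) x a → u ≢ x → paint f x a u ≡ f u
  paint-≢ {u = u} f x a u≢x rewrite dec-false (u ≟ x) u≢x = refl

  paint-proper : ∀ {col : Fin n → Fin k} {δ} → Proper h col → δ ∉ forbidden col ⁅ x ⁆ x h →
    Proper h (paint col x δ)
  paint-proper {h = h} {x = x} {col = col} {δ} proper δ-free = recolour proper
    (λ u u∉⁅x⁆ → paint-≢ col x δ (u∉⁅x⁆ ∘ λ { refl → x∈⁅x⁆ x }))
    (λ u u∈⁅x⁆ → subst (λ w → paint col x δ w ∉ forbidden col ⁅ x ⁆ w h) (sym (x∈⁅y⁆⇒x≡y x u∈⁅x⁆))
                   (subst (_∉ forbidden col ⁅ x ⁆ x h) (sym (paint-≡ col x δ)) δ-free))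
    (λ u v u∈⁅x⁆ v∈⁅x⁆ uv → ⊥-elim (Proper⇒≢ proper uv (trans (x∈⁅y⁆⇒x≡y x u∈⁅x⁆) (sym (x∈⁅y⁆⇒x≡y x v∈⁅x⁆)))))

  legal-join : ∀ {col : Fin n → Fin k} → Proper h col → y ≢ x →
    col y ∉ forbidden col ⁅ x ⁆ x h → ∣ forbidden col ⁅ x ⁆ x h ∣ + 1 < k → Legal k h (x , y)
  legal-join {h = h} {y = y} {x = x} {col = col} proper y≢x y-free bound
    with δ , δ-free , δ∉cy ← ∃∉∧∉ᴸ (forbidden col ⁅ x ⁆ x h) [ col y ] bound =
    ≢-sym y≢x , (λ xy → y-free (forbidden⁺ col xy (x≢y⇒x∉⁅y⁆ y≢x))) , paint col x δ ,
    Proper-∷ʳ (paint-proper proper δ-free)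
      (λ eq → δ∉cy (here (trans (sym (paint-≡ col x δ)) (trans eq (paint-≢ col x δ y≢x)))))

  Forces-now : ∀ {P : History n → Set} r → P h → Forces k P r h
  Forces-now zero p = p
  Forces-now (suc r) p = inj₁ p

  missing : History n → Edge n → Bool
  missing h (u , v) with adj? h u v
  ... | yes _ = false
  ... | no _ = true

  missing-¬Adj : ¬ Adj h u v → missing h (u , v) ≡ true
  missing-¬Adj {h = h} {u} {v} u≁v with adj? h u v
  ... | yes uv = ⊥-elim (u≁v uv)
  ... | no _ = refl

  missing-Adj : Adj h u v → missing h (u , v) ≡ false
  missing-Adj {h = h} {u} {v} uv with adj? h u v
  ... | yes _ = refl
  ... | no u≁v = ⊥-elim (u≁v uv)

  missing-++ : ∀ xs e → missing (h ++ xs) e ≡ true → missing h e ≡ true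
  missing-++ {h = h} xs (u , v) missing′ with adj? h u v
  ... | yes uv rewrite missing-Adj (Adj-++ xs uv) with () ← missing′
  ... | no _ = refl

-- Maxi's strategy for completing a triangle

-- The prospective V_{i+1} = {a, b, c}, and a spare vertex d ∈ W witnessing that the game is not over.
record Frame {n : ℕ} (W : Subset n) : Set where
  field
    a b c d : Fin n
    distinct : Distinct3 a b c
    d∉corners : d ∉ᴸ a ∷ b ∷ c ∷ []
    corners⊆W : All (_∈ W) (a ∷ b ∷ c ∷ [])
    d∈W : d ∈ W

  corners : List (Fin n)
  corners = a ∷ b ∷ c ∷ []

  Corners : Subset n
  Corners = fromList corners

  sides : List (Edge n)
  sides = (a , b) ∷ (b , c) ∷ (a , c) ∷ []

  rest : Subset n
  rest = W ─ Corners

module _ {n : ℕ} {W : Subset n} (F : Frame W) where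
  open Frame F

  private variable
    k : ℕ
    h : History n
    u v x y : Fin n

  escaping : History n → ℕ
  escaping h = count (touches rest) h

  missingSides : History n → ℕ
  missingSides h = count (missing h) sides

  crossing : History n → ℕ
  crossing h = count (crosses Corners) h

  a∈ : a ∈ᴸ corners
  a∈ = here refl

  b∈ : b ∈ᴸ corners
  b∈ = there (here refl)

  c∈ : c ∈ᴸ corners
  c∈ = there (there (here refl))

  corner⇒mem : u ∈ᴸ corners → mem Corners u ≡ true
  corner⇒mem = []=⇒lookup ∘ ∈fromList⁺

  corner⇒mem-rest : u ∈ᴸ corners → mem rest u ≡ false
  corner⇒mem-rest u∈ = ∉⇒mem≡false (x∈q⇒x∉p─q W Corners (∈fromList⁺ u∈))

  d∈rest : mem rest d ≡ true
  d∈rest = []=⇒lookup (x∈p∧x∉q⇒x∈p─q d∈W (d∉corners ∘ ∈fromList⁻ corners))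

  corner≢d : x ∈ᴸ corners → x ≢ d
  corner≢d x∈ refl = d∉corners x∈

  side⇒corners : (x , y) ∈ᴸ sides → x ∈ᴸ corners × y ∈ᴸ corners × x ≢ y
  side⇒corners (here refl) = a∈ , b∈ , proj₁ distinct
  side⇒corners (there (here refl)) = b∈ , c∈ , proj₁ (proj₂ distinct)
  side⇒corners (there (there (here refl))) = a∈ , c∈ , proj₂ (proj₂ distinct)

  corners⇒side : u ∈ᴸ corners → v ∈ᴸ corners → u ≢ v → (u , v) ∈ᴸ sides ⊎ (v , u) ∈ᴸ sides
  corners⇒side (here refl) (here refl) u≢v = ⊥-elim (u≢v refl)
  corners⇒side (here refl) (there (here refl)) _ = inj₁ (here refl)
  corners⇒side (here refl) (there (there (here refl))) _ = inj₁ (there (there (here refl)))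
  corners⇒side (there (here refl)) (here refl) _ = inj₂ (here refl)
  corners⇒side (there (here refl)) (there (here refl)) u≢v = ⊥-elim (u≢v refl)
  corners⇒side (there (here refl)) (there (there (here refl))) _ = inj₁ (there (here refl))
  corners⇒side (there (there (here refl))) (here refl) _ = inj₂ (there (there (here refl)))
  corners⇒side (there (there (here refl))) (there (here refl)) _ = inj₂ (there (here refl))
  corners⇒side (there (there (here refl))) (there (there (here refl))) u≢v = ⊥-elim (u≢v refl)

  sides-injective : ∀ {A : Set} (f : Fin n → A) → Distinct3 (f a) (f b) (f c) → (x , y) ∈ᴸ sides → f x ≢ f y
  sides-injective f (fa≢fb , _ , _) (here refl) = fa≢fb
  sides-injective f (_ , fb≢fc , _) (there (here refl)) = fb≢fc
  sides-injective f (_ , _ , fa≢fc) (there (there (here refl))) = fa≢fc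

  corners-injective : ∀ {A : Set} (f : Fin n → A) → Distinct3 (f a) (f b) (f c) →
    u ∈ᴸ corners → v ∈ᴸ corners → u ≢ v → f u ≢ f v
  corners-injective f distinct-f u∈ v∈ u≢v with corners⇒side u∈ v∈ u≢v
  ... | inj₁ uv∈ = sides-injective f distinct-f uv∈
  ... | inj₂ vu∈ = ≢-sym (sides-injective f distinct-f vu∈)

  Corners-clique : All (λ e → Adj h (proj₁ e) (proj₂ e)) sides → Clique h Corners
  Corners-clique {h = h} present u v u∈ v∈ u≢v
    with corners⇒side (∈fromList⁻ corners u∈) (∈fromList⁻ corners v∈) u≢v
  ... | inj₁ uv∈ = All.lookup present uv∈
  ... | inj₂ vu∈ = Adj-sym (All.lookup present vu∈)

  nextStage : All (λ e → Adj h (proj₁ e) (proj₂ e)) sides → escaping h ≤ 3 → NextStage W h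
  nextStage {h = h} present escaping≤3 =
    Corners , fromList⊆ corners⊆W , ∣fromList∣≡length (Distinct3⇒AllPairs distinct) ,
    Corners-clique present , subst (_≤ 3) (sym (phi≡count-touches h rest)) escaping≤3

  joins-corner⇒crosses : ∀ e x → x ∈ᴸ corners → joins Corners x e ≡ true → crosses Corners e ≡ true
  joins-corner⇒crosses (u , v) x x∈ j with joins⁻ Corners x u v j
  ... | inj₁ (refl , Cv≡false) rewrite corner⇒mem x∈ | Cv≡false = refl
  ... | inj₂ (refl , Cu≡false) rewrite corner⇒mem x∈ | Cu≡false = refl

  joins-corners-disjoint : ∀ e x y → x ∈ᴸ corners → y ∈ᴸ corners → x ≢ y →
    joins Corners x e ≡ true → joins Corners y e ≡ false
  joins-corners-disjoint (u , v) x y x∈ y∈ x≢y jx with joins Corners y (u , v) in jy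
  ... | false = refl
  ... | true with joins⁻ Corners x u v jx | joins⁻ Corners y u v jy
  ...   | inj₁ (refl , _) | inj₁ (refl , _) = ⊥-elim (x≢y refl)
  ...   | inj₂ (refl , _) | inj₂ (refl , _) = ⊥-elim (x≢y refl)
  ...   | inj₁ (refl , _) | inj₂ (_ , Cu≡false) with () ← trans (sym (corner⇒mem x∈)) Cu≡false
  ...   | inj₂ (_ , Cu≡false) | inj₁ (refl , _) with () ← trans (sym (corner⇒mem y∈)) Cu≡false

  ∑forbidden≤crossing : ∀ (col : Fin n → Fin k) h →
    ∣ forbidden col Corners a h ∣ + ∣ forbidden col Corners b h ∣ + ∣ forbidden col Corners c h ∣ ≤ crossing h
  ∑forbidden≤crossing col h = begin
    ∣ forbidden col Corners a h ∣ + ∣ forbidden col Corners b h ∣ + ∣ forbidden col Corners c h ∣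
      ≤⟨ +-mono-≤ (+-mono-≤ (∣forbidden∣≤count-joins col Corners a h) (∣forbidden∣≤count-joins col Corners b h))
                  (∣forbidden∣≤count-joins col Corners c h) ⟩
    count ja h + count jb h + count jc h
      ≡⟨ cong (_+ count jc h) (count-∨ (λ e → joins-corners-disjoint e a b a∈ b∈ (proj₁ distinct)) h) ⟩
    count (λ e → ja e ∨ jb e) h + count jc h
      ≡⟨ count-∨ ab-disjoint-c h ⟩
    count (λ e → (ja e ∨ jb e) ∨ jc e) h
      ≤⟨ count-mono joins⇒crosses h ⟩
    crossing h ∎
    where
      open ≤-Reasoning
      ja = joins Corners a
      jb = joins Corners b
      jc = joins Corners c
      ab-disjoint-c : ∀ e → (ja e ∨ jb e) ≡ true → jc e ≡ false
      ab-disjoint-c e jab with ∨-true⁻ (ja e) jab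
      ... | inj₁ ja≡true = joins-corners-disjoint e a c a∈ c∈ (proj₂ (proj₂ distinct)) ja≡true
      ... | inj₂ jb≡true = joins-corners-disjoint e b c b∈ c∈ (proj₁ (proj₂ distinct)) jb≡true
      joins⇒crosses : ∀ e → ((ja e ∨ jb e) ∨ jc e) ≡ true → crosses Corners e ≡ true
      joins⇒crosses e j with ∨-true⁻ (ja e ∨ jb e) j
      ... | inj₂ jc≡true = joins-corner⇒crosses e c c∈ jc≡true
      ... | inj₁ jab with ∨-true⁻ (ja e) jab
      ...   | inj₁ ja≡true = joins-corner⇒crosses e a a∈ ja≡true
      ...   | inj₂ jb≡true = joins-corner⇒crosses e b b∈ jb≡true

  paintCorners : (Fin n → Fin k) → Fin k → Fin k → Fin k → Fin n → Fin k
  paintCorners col α β γ = paint (paint (paint col c γ) b β) a α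

  paintCorners-corners : ∀ (col : Fin n → Fin k) α β γ →
    paintCorners col α β γ a ≡ α × paintCorners col α β γ b ≡ β × paintCorners col α β γ c ≡ γ
  paintCorners-corners col α β γ =
    paint-≡ col₂ a α ,
    trans (paint-≢ col₂ a α (≢-sym a≢b)) (paint-≡ col₁ b β) ,
    trans (paint-≢ col₂ a α (≢-sym a≢c)) (trans (paint-≢ col₁ b β (≢-sym b≢c)) (paint-≡ col c γ))
    where
      col₁ = paint col c γ
      col₂ = paint col₁ b β
      a≢b = proj₁ distinct
      b≢c = proj₁ (proj₂ distinct)
      a≢c = proj₂ (proj₂ distinct)

  paintCorners-off : ∀ (col : Fin n → Fin k) α β γ → u ∉ Corners → paintCorners col α β γ u ≡ col u
  paintCorners-off col α β γ u∉ =
    trans (paint-≢ col₂ a α (u≢ a∈)) (trans (paint-≢ col₁ b β (u≢ b∈)) (paint-≢ col c γ (u≢ c∈)))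
    where
      col₁ = paint col c γ
      col₂ = paint col₁ b β
      u≢ : x ∈ᴸ corners → _ ≢ x
      u≢ x∈ refl = u∉ (∈fromList⁺ x∈)

  paintCorners-distinct : ∀ (col : Fin n → Fin k) {α β γ} → Distinct3 α β γ →
    Distinct3 (paintCorners col α β γ a) (paintCorners col α β γ b) (paintCorners col α β γ c)
  paintCorners-distinct col {α} {β} {γ} αβγ
    rewrite proj₁ (paintCorners-corners col α β γ) | proj₁ (proj₂ (paintCorners-corners col α β γ))
          | proj₂ (proj₂ (paintCorners-corners col α β γ)) = αβγ

  paintCorners-proper : ∀ {col : Fin n → Fin k} {α β γ} → Proper h col → Distinct3 α β γ →
    α ∉ forbidden col Corners a h → β ∉ forbidden col Corners b h → γ ∉ forbidden col Corners c h →
    Proper h (paintCorners col α β γ)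
  paintCorners-proper {h = h} {col} {α} {β} {γ} proper αβγ α-free β-free γ-free =
    recolour proper (λ u → paintCorners-off col α β γ) avoid within
    where
      Φ = λ x → forbidden col Corners x h
      painted = paintCorners-corners col α β γ
      avoid : ∀ u → u ∈ Corners → paintCorners col α β γ u ∉ Φ u
      avoid u u∈ with ∈fromList⁻ corners u∈
      ... | here refl = subst (_∉ Φ a) (sym (proj₁ painted)) α-free
      ... | there (here refl) = subst (_∉ Φ b) (sym (proj₁ (proj₂ painted))) β-free
      ... | there (there (here refl)) = subst (_∉ Φ c) (sym (proj₂ (proj₂ painted))) γ-free
      within : ∀ u v → u ∈ Corners → v ∈ Corners → Adj h u v →
        paintCorners col α β γ u ≢ paintCorners col α β γ v
      within u v u∈ v∈ uv = corners-injective (paintCorners col α β γ) (paintCorners-distinct col αβγ)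
        (∈fromList⁻ corners u∈) (∈fromList⁻ corners v∈) (Proper⇒≢ proper uv)

  recolourCorners : ∀ {col : Fin n → Fin 4} → Proper h col → crossing h ≤ 5 →
    Σ (Fin n → Fin 4) λ col′ → Proper h col′ × Distinct3 (col′ a) (col′ b) (col′ c)
  recolourCorners {h = h} {col} proper crossing≤5
    with α , β , γ , (α-free , β-free , γ-free) , αβγ ←
         distinctAvoiders (forbidden col Corners a h) (forbidden col Corners b h) (forbidden col Corners c h)
           (≤-pred (∣forbidden∣<k Corners a proper)) (≤-pred (∣forbidden∣<k Corners b proper))
           (≤-pred (∣forbidden∣<k Corners c proper))
           (≤-trans (∑forbidden≤crossing col h) crossing≤5) =
    paintCorners col α β γ , paintCorners-proper proper αβγ α-free β-free γ-free , paintCorners-distinct col αβγ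

  notSaturated : ∀ {col : Fin n → Fin 4} → Proper h col → Distinct3 (col a) (col b) (col c) →
    escaping h ≤ 2 → ¬ Saturated 4 h
  notSaturated {h = h} {col} proper distinct-col escaping≤2 saturated =
    [ join a∈ , [ join b∈ , join c∈ ]′ ]′ (one-of-three-∉ Φ ∣Φ∣≤2 distinct-col)
    where
      Φ = forbidden col ⁅ d ⁆ d h
      joins⇒touches : ∀ e → joins ⁅ d ⁆ d e ≡ true → touches rest e ≡ true
      joins⇒touches (u , v) j with joins⁻ ⁅ d ⁆ d u v j
      ... | inj₁ (refl , _) rewrite d∈rest = refl
      ... | inj₂ (refl , _) rewrite d∈rest = ∨-zeroʳ _
      ∣Φ∣≤2 : ∣ Φ ∣ ≤ 2
      ∣Φ∣≤2 = ≤-trans (∣forbidden∣≤count-joins col ⁅ d ⁆ d h) (≤-trans (count-mono joins⇒touches h) escaping≤2)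
      join : x ∈ᴸ corners → col x ∉ Φ → Empty.⊥
      join {x} x∈ cx∉Φ = saturated (d , x) (legal-join proper (corner≢d x∈) cx∉Φ (s≤s (+-monoˡ-≤ 1 ∣Φ∣≤2)))

  escaping-side : ∀ h → (x , y) ∈ᴸ sides → escaping (h ++ [ (x , y) ]) ≡ escaping h
  escaping-side {x} {y} h xy∈ with side⇒corners xy∈
  ... | x∈ , y∈ , _ rewrite count-∷ʳ (touches rest) h (x , y) | corner⇒mem-rest x∈ | corner⇒mem-rest y∈ =
    +-identityʳ (escaping h)

  crossing-side : ∀ h → (x , y) ∈ᴸ sides → crossing (h ++ [ (x , y) ]) ≡ crossing h
  crossing-side {x} {y} h xy∈ with side⇒corners xy∈
  ... | x∈ , y∈ , _ rewrite count-∷ʳ (crosses Corners) h (x , y) | corner⇒mem x∈ | corner⇒mem y∈ =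
    +-identityʳ (crossing h)

  missingSides-pos : (x , y) ∈ᴸ sides → ¬ Adj h x y → 0 < missingSides h
  missingSides-pos {h = h} xy∈ x≁y = count-pos {p = missing h} xy∈ (missing-¬Adj x≁y)

  missingSides-side : (x , y) ∈ᴸ sides → ¬ Adj h x y → missingSides (h ++ [ (x , y) ]) < missingSides h
  missingSides-side {h = h} xy∈ x≁y =
    count-< (missing-++ {h = h} [ _ ]) xy∈ (missing-Adj (inj₁ (∈-++⁺ʳ h (here refl)))) (missing-¬Adj x≁y)

  missingSides-present : (x , y) ∈ᴸ sides → Adj h x y → missingSides h ≤ 2
  missingSides-present {h = h} xy∈ xy =
    ≤-pred (count-< {p = missing h} {q = λ _ → true} (λ _ _ → refl) xy∈ (missing-Adj xy) refl)

  missingSides≤2 : x ∈ᴸ corners → y ∈ᴸ corners → x ≢ y → Adj h x y → missingSides h ≤ 2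
  missingSides≤2 x∈ y∈ x≢y xy with corners⇒side x∈ y∈ x≢y
  ... | inj₁ xy∈ = missingSides-present xy∈ xy
  ... | inj₂ yx∈ = missingSides-present yx∈ (Adj-sym xy)

  missingSides-++ : ∀ h xs → missingSides (h ++ xs) ≤ missingSides h
  missingSides-++ h xs = count-mono (missing-++ {h = h} xs) sides

  Budget : History n → Set
  Budget h = escaping h + missingSides h ≤ 3

  crossing≤phi : ∀ h → crossing h ≤ phi h W
  crossing≤phi h = begin
    crossing h            ≤⟨ count-mono (λ e → touches-⊆ (fromList⊆ corners⊆W) e ∘ crosses⇒touches Corners e) h ⟩
    count (touches W) h   ≡⟨ sym (phi≡count-touches h W) ⟩
    phi h W               ∎
    where open ≤-Reasoning

  -- With r rounds left: each round Maxi closes a side and Mini adds at most one escaping edge, which keeps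
  -- the budget; and at most 3 + (3 − r) ≤ 5 edges leave the corners whenever Maxi still has to move.
  record Invariant (r : ℕ) (h : History n) : Set where
    field
      colourable : Colorable 4 h
      budget : Budget h
      missing≤rounds : missingSides h ≤ r
      crossing-room : crossing h + r ≤ 6

  Invariant-after-round : ∀ {r f} → Invariant (suc r) h → (x , y) ∈ᴸ sides → ¬ Adj h x y →
    Colorable 4 ((h ++ [ (x , y) ]) ++ [ f ]) → Invariant r ((h ++ [ (x , y) ]) ++ [ f ])
  Invariant-after-round {h = h} {x} {y} {r} {f} inv xy∈ x≁y colourable″ = record
    { colourable = colourable″
    ; budget = begin
        escaping h″ + missingSides h″      ≤⟨ +-mono-≤ escaping″≤ (missingSides-++ h′ [ f ]) ⟩
        escaping h + 1 + missingSides h′   ≡⟨ +-assoc (escaping h) 1 (missingSides h′) ⟩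
        escaping h + suc (missingSides h′) ≤⟨ +-monoʳ-≤ (escaping h) (missingSides-side xy∈ x≁y) ⟩
        escaping h + missingSides h        ≤⟨ budget ⟩
        3                                  ∎
    ; missing≤rounds =
        ≤-trans (missingSides-++ h′ [ f ]) (≤-pred (≤-trans (missingSides-side xy∈ x≁y) missing≤rounds))
    ; crossing-room = begin
        crossing h″ + r         ≤⟨ +-monoˡ-≤ r crossing″≤ ⟩
        crossing h + 1 + r      ≡⟨ +-assoc (crossing h) 1 r ⟩
        crossing h + suc r      ≤⟨ crossing-room ⟩
        6                       ∎
    }
    where
      open Invariant inv
      open ≤-Reasoning
      h′ = h ++ [ (x , y) ]
      h″ = h′ ++ [ f ]
      escaping″≤ : escaping h″ ≤ escaping h + 1
      escaping″≤ = subst (λ m → escaping h″ ≤ m + 1) (escaping-side h xy∈) (count-∷ʳ≤ (touches rest) h′ f)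
      crossing″≤ : crossing h″ ≤ crossing h + 1
      crossing″≤ = subst (λ m → crossing h″ ≤ m + 1) (crossing-side h xy∈) (count-∷ʳ≤ (crosses Corners) h′ f)

  round : ∀ {r} → Invariant (suc r) h → (x , y) ∈ᴸ sides → ¬ Adj h x y →
    (∀ h″ → Invariant r h″ → Forces 4 (NextStage W) r h″) → Forces 4 (NextStage W) (suc r) h
  round {h = h} {x} {y} inv xy∈ x≁y continue =
    let col′ , proper′ , distinct′ = recolourCorners (proj₂ colourable) crossing≤5
        x∈ , y∈ , x≢y = side⇒corners xy∈
        proper-xy = Proper-∷ʳ proper′ (corners-injective col′ distinct′ x∈ y∈ x≢y)
    in inj₂ ((x , y) , (x≢y , x≁y , col′ , proper-xy) , notSaturated proper-xy distinct′ escaping′≤2 ,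
             λ f legal-f → continue _ (Invariant-after-round inv xy∈ x≁y (proj₂ (proj₂ legal-f))))
    where
      open Invariant inv
      crossing≤5 : crossing h ≤ 5
      crossing≤5 = +-cancelʳ-≤ 1 (crossing h) 5 (≤-trans (+-monoʳ-≤ (crossing h) (s≤s z≤n)) crossing-room)
      escaping≤2 : escaping h ≤ 2
      escaping≤2 =
        +-cancelʳ-≤ 1 (escaping h) 2 (≤-trans (+-monoʳ-≤ (escaping h) (missingSides-pos xy∈ x≁y)) budget)
      escaping′≤2 : escaping (h ++ [ (x , y) ]) ≤ 2
      escaping′≤2 = subst (_≤ 2) (sym (escaping-side h xy∈)) escaping≤2

  adjacent? : ∀ h (e : Edge n) → Dec (Adj h (proj₁ e) (proj₂ e))
  adjacent? h (u , v) = adj? h u v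

  strategy : ∀ r h → Invariant r h → Forces 4 (NextStage W) r h
  strategy r h inv with all? (adjacent? h) sides
  ... | yes complete = Forces-now r (nextStage complete (m+n≤o⇒m≤o _ (Invariant.budget inv)))
  ... | no incomplete with (x , y) , xy∈ , x≁y ← find (¬All⇒Any¬ (adjacent? h) sides incomplete) | r
  ...   | zero = ⊥-elim (<⇒≱ (missingSides-pos xy∈ x≁y) (Invariant.missing≤rounds inv))
  ...   | suc r′ = round inv xy∈ x≁y (strategy r′)

  initial : Colorable 4 h → phi h W ≤ 3 → Budget h → Invariant 3 h
  initial {h = h} colourable φ≤3 budget = record
    { colourable = colourable
    ; budget = budget
    ; missing≤rounds = count≤length (missing h) sides
    ; crossing-room = +-monoˡ-≤ 3 (≤-trans (crossing≤phi h) φ≤3)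
    }

-- Choosing the triangle

module _ {n : ℕ} where
  isolated : Subset n → History n → Edge n → Bool
  isolated W h (u , v) = mem W u ∧ mem W v ∧ (deg h u ≡ᵇ 1) ∧ (deg h v ≡ᵇ 1)

  isolated⇒touches : ∀ W h e → isolated W h e ≡ true → touches W e ≡ true
  isolated⇒touches W h (u , v) iso with mem W u
  ... | true = refl

  private variable
    u v x : Fin n

  incident-false : u ≢ x → v ≢ x → incident x (u , v) ≡ false
  incident-false {u} {x} {v} u≢x v≢x rewrite dec-false (u ≟ x) u≢x | dec-false (v ≟ x) v≢x = refl

  incident-fst : incident u (u , v) ≡ true
  incident-fst {u} rewrite dec-true (u ≟ u) refl = refl

  incident-snd : incident v (u , v) ≡ true
  incident-snd {v} rewrite dec-true (v ≟ v) refl = ∨-zeroʳ _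

module Selection {n : ℕ} {W : Subset n} {h : History n}
  (4≤∣W∣ : 4 ≤ ∣ W ∣) (loopless : ∀ {u} → ¬ Adj h u u) (isolated≤1 : isolatedIn h W ≤ 1) where

  private variable
    u v w x y z : Fin n
    e : Edge n
    L : List (Edge n)

  Represents : List (Edge n) → Set
  Represents L = filterᵇ (touches W) h ↭ L

  Represents-count : ∀ p → (∀ e → p e ≡ true → touches W e ≡ true) → Represents L → count p h ≡ count p L
  Represents-count p p⇒touches rep = trans (sym (count-filter p⇒touches h)) (count-↭ p rep)

  Represents-∈ : Represents L → e ∈ᴸ L → e ∈ᴸ h × touches W e ≡ true
  Represents-∈ rep e∈L with ∈-filter⁻ (T? ∘ touches W) (∈-resp-↭ (↭-sym rep) e∈L)
  ... | e∈h , t = e∈h , Equivalence.to T-≡ t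

  Selection : Set
  Selection = Σ (Frame W) λ F → Budget F h

  extend-to : ∀ is → length is < ∣ W ∣ → z ∈ W → ∃ λ c → c ∈ W × c ∉ᴸ is × z ∈ᴸ c ∷ is
  extend-to {z} is bound z∈W with z ∈ᴸ? is
  ... | yes z∈is = let c , c∈W , c∉is = ∃∈∧∉ᴸ W is bound in c , c∈W , c∉is , there z∈is
  ... | no z∉is = z , z∈W , z∉is , here refl

  frameThrough : x ∈ W → y ∈ W → z ∈ W →
    (∀ F → All (_∈ᴸ Frame.corners F) (x ∷ y ∷ z ∷ []) → Budget F h) → Selection
  frameThrough {x} {y} {z} x∈W y∈W z∈W budget
    with b , b∈W , b∉x , y∈bx ← extend-to (x ∷ []) (≤-trans (s≤s (s≤s z≤n)) 4≤∣W∣) y∈W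
    with a , a∈W , a∉bx , z∈abx ← extend-to (b ∷ x ∷ []) (≤-trans (s≤s (s≤s (s≤s z≤n))) 4≤∣W∣) z∈W
    with d , d∈W , d∉abx ← ∃∈∧∉ᴸ W (a ∷ b ∷ x ∷ []) 4≤∣W∣ =
    F , budget F (there (there (here refl)) ∷ there y∈bx ∷ z∈abx ∷ [])
    where
      F : Frame W
      F = record
        { a = a ; b = b ; c = x ; d = d
        ; distinct = a∉bx ∘ here , b∉x ∘ here , a∉bx ∘ there ∘ here
        ; d∉corners = d∉abx
        ; corners⊆W = a∈W ∷ b∈W ∷ x∈W ∷ []
        ; d∈W = d∈W
        }

  Covered : Frame W → Edge n → Set
  Covered F e = touches (Frame.rest F) e ≡ false

  mem-rest≡false : (F : Frame W) → u ∉ W ⊎ u ∈ᴸ Frame.corners F → mem (Frame.rest F) u ≡ false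
  mem-rest≡false F (inj₁ u∉W) = ∉⇒mem≡false (u∉W ∘ p─q⊆p W (Frame.Corners F))
  mem-rest≡false F (inj₂ u∈) = corner⇒mem-rest F u∈

  covered : (F : Frame W) → u ∉ W ⊎ u ∈ᴸ Frame.corners F → v ∉ W ⊎ v ∈ᴸ Frame.corners F → Covered F (u , v)
  covered F u-ok v-ok rewrite mem-rest≡false F u-ok | mem-rest≡false F v-ok = refl

  data Kind : Edge n → Set where
    pendant : ∀ w → w ∈ W → (∀ F → w ∈ᴸ Frame.corners F → Covered F e) → Kind e
    internal : u ∈ W → v ∈ W → Kind (u , v)

  kind : ∀ e → touches W e ≡ true → Kind e
  kind (u , v) t with u ∈? W | v ∈? W
  ... | yes u∈W | yes v∈W = internal u∈W v∈W
  ... | yes u∈W | no v∉W = pendant u u∈W λ F u∈ → covered F (inj₂ u∈) (inj₁ v∉W)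
  ... | no u∉W | yes v∈W = pendant v v∈W λ F v∈ → covered F (inj₁ u∉W) (inj₂ v∈)
  ... | no u∉W | no v∉W rewrite ∉⇒mem≡false u∉W | ∉⇒mem≡false v∉W with () ← t

  data Attach (u v : Fin n) : Edge n → Set where
    via : ∀ w → w ∈ W → (∀ F → All (_∈ᴸ Frame.corners F) (u ∷ v ∷ w ∷ []) → Covered F e) → Attach u v e
    apart : ∀ {u′ v′} → u′ ∈ W → v′ ∈ W → u′ ∉ᴸ u ∷ v ∷ [] → v′ ∉ᴸ u ∷ v ∷ [] → Attach u v (u′ , v′)

  attach : ∀ u v e → touches W e ≡ true → Attach u v e
  attach u v e t with kind e t
  ... | pendant w w∈W cov = via w w∈W λ { F (_ ∷ _ ∷ w∈ ∷ []) → cov F w∈ }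
  attach u v (u′ , v′) t | internal u′∈W v′∈W with u′ ∈ᴸ? (u ∷ v ∷ []) | v′ ∈ᴸ? (u ∷ v ∷ [])
  ... | yes u′∈uv | _ = via v′ v′∈W λ F uvv′ →
    covered F (inj₂ (All.lookup uvv′ (∈-++⁺ˡ u′∈uv))) (inj₂ (All.lookup uvv′ (there (there (here refl)))))
  ... | no _ | yes v′∈uv = via u′ u′∈W λ F uvu′ →
    covered F (inj₂ (All.lookup uvu′ (there (there (here refl))))) (inj₂ (All.lookup uvu′ (∈-++⁺ˡ v′∈uv)))
  ... | no u′∉uv | no v′∉uv = apart u′∈W v′∈W u′∉uv v′∉uv

  escaping≡count : (F : Frame W) → Represents L → escaping F h ≡ count (touches (Frame.rest F)) L
  escaping≡count F = Represents-count (touches (Frame.rest F)) (touches-⊆ (p─q⊆p W (Frame.Corners F)))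

  all-covered⇒budget : (F : Frame W) → Represents L → All (Covered F) L → Budget F h
  all-covered⇒budget {L} F rep all-covered rewrite escaping≡count F rep | count-none all-covered =
    count≤length (missing h) (Frame.sides F)

  side⇒budget : (F : Frame W) → Represents ((u , v) ∷ e ∷ L) → u ∈ᴸ Frame.corners F → v ∈ᴸ Frame.corners F →
    Covered F e → length L ≤ 1 → Budget F h
  side⇒budget {u} {v} {e} {L} F rep u∈ v∈ e-covered L≤1 =
    +-mono-≤ escaping≤1 (missingSides≤2 F u∈ v∈ (λ { refl → loopless uv }) uv)
    where
      rest = Frame.rest F
      uv : Adj h u v
      uv = inj₁ (proj₁ (Represents-∈ rep (here refl)))
      escaping≤1 : escaping F h ≤ 1
      escaping≤1 rewrite escaping≡count F rep | count-∷ (touches rest) (u , v) (e ∷ L) | covered F (inj₂ u∈) (inj₂ v∈)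
                       | count-∷ (touches rest) e L | e-covered = ≤-trans (count≤length (touches rest) L) L≤1

  Avoids : Fin n → Fin n → Edge n → Set
  Avoids u v e = incident u e ≡ false × incident v e ≡ false

  apart-avoids : ∀ {u′ v′} → u′ ∉ᴸ u ∷ v ∷ [] → v′ ∉ᴸ u ∷ v ∷ [] →
    Avoids u v (u′ , v′) × Avoids u′ v′ (u , v)
  apart-avoids u′∉ v′∉ =
    (incident-false (u′∉ ∘ here) (v′∉ ∘ here) ,
     incident-false (u′∉ ∘ there ∘ here) (v′∉ ∘ there ∘ here)) ,
    (incident-false (u′∉ ∘ here ∘ sym) (u′∉ ∘ there ∘ here ∘ sym) ,
     incident-false (v′∉ ∘ here ∘ sym) (v′∉ ∘ there ∘ here ∘ sym))

  deg≡1 : x ∈ W → Represents (e ∷ L) → incident x e ≡ true → All (λ e → incident x e ≡ false) L → deg h x ≡ 1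
  deg≡1 {x} {e} {L} x∈W rep on-e off-L
    rewrite Represents-count (incident x) (incident⇒touches x∈W) rep
          | count-∷ (incident x) e L | on-e | count-none off-L = refl

  isolated-edge : Represents ((u , v) ∷ L) → u ∈ W → v ∈ W → All (Avoids u v) L → isolated W h (u , v) ≡ true
  isolated-edge {u} {v} rep u∈W v∈W avoids
    rewrite []=⇒lookup u∈W | []=⇒lookup v∈W
          | deg≡1 u∈W rep (incident-fst {u = u} {v = v}) (All.map proj₁ avoids)
          | deg≡1 v∈W rep (incident-snd {v = v} {u = u}) (All.map proj₂ avoids) = refl

  two-isolated : ∀ {e e′} → Represents (e ∷ e′ ∷ L) → isolated W h e ≡ true → isolated W h e′ ≡ true →
    2 ≤ isolatedIn h W
  two-isolated {L} {e} {e′} rep iso-e iso-e′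
    rewrite Represents-count (isolated W h) (isolated⇒touches W h) rep
          | count-∷ (isolated W h) e (e′ ∷ L) | iso-e | count-∷ (isolated W h) e′ L | iso-e′ = s≤s (s≤s z≤n)

  touches-at : Represents L → e ∈ᴸ L → touches W e ≡ true
  touches-at rep = proj₂ ∘ Represents-∈ rep

  Represents-swap : ∀ {e₁ e₂} → Represents (e₁ ∷ e₂ ∷ L) → Represents (e₂ ∷ e₁ ∷ L)
  Represents-swap rep = ↭-trans rep (swap _ _ ↭-refl)

  through-edge : (F : Frame W) → All (_∈ᴸ Frame.corners F) (u ∷ v ∷ w ∷ []) → Covered F (u , v)
  through-edge F (u∈ ∷ v∈ ∷ _ ∷ []) = covered F (inj₂ u∈) (inj₂ v∈)

  pairUp : Represents ((u , v) ∷ e ∷ []) → u ∈ W → v ∈ W → Selection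
  pairUp {u} {v} {e} rep u∈W v∈W with attach u v e (touches-at rep (there (here refl)))
  ... | via w w∈W cov =
    frameThrough u∈W v∈W w∈W λ F uvw → all-covered⇒budget F rep (through-edge F uvw ∷ cov F uvw ∷ [])
  ... | apart u′∈W v′∈W u′∉ v′∉ = ⊥-elim (<⇒≱ (two-isolated rep isolated-uv isolated-u′v′) isolated≤1)
    where
      isolated-uv = isolated-edge rep u∈W v∈W (proj₁ (apart-avoids u′∉ v′∉) ∷ [])
      isolated-u′v′ = isolated-edge (Represents-swap rep) u′∈W v′∈W (proj₂ (apart-avoids u′∉ v′∉) ∷ [])

  -- If neither e₁ nor e₂ fits into a triangle with uv, both lie inside W and miss u and v; if they do not
  -- fit into one triangle together either, uv and e₁ are two isolated edges.
  tripleUp : ∀ {e₁ e₂} → Represents ((u , v) ∷ e₁ ∷ e₂ ∷ []) → u ∈ W → v ∈ W → Selection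
  tripleUp {u} {v} {e₁} {e₂} rep u∈W v∈W
    with attach u v e₁ (touches-at rep (there (here refl)))
       | attach u v e₂ (touches-at rep (there (there (here refl))))
  ... | via w w∈W cov | _ = frameThrough u∈W v∈W w∈W λ { F uvw@(u∈ ∷ v∈ ∷ _) →
    side⇒budget F rep u∈ v∈ (cov F uvw) (s≤s z≤n) }
  ... | apart _ _ _ _ | via w w∈W cov = frameThrough u∈W v∈W w∈W λ { F uvw@(u∈ ∷ v∈ ∷ _) →
    side⇒budget F (↭-trans rep (prep _ (swap _ _ ↭-refl))) u∈ v∈ (cov F uvw) (s≤s z≤n) }
  ... | apart {u₁} {v₁} u₁∈W v₁∈W u₁∉ v₁∉ | apart {u₂} {v₂} u₂∈W v₂∈W u₂∉ v₂∉
    with attach u₁ v₁ (u₂ , v₂) (touches-at rep (there (there (here refl))))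
  ...   | via w w∈W cov = frameThrough u₁∈W v₁∈W w∈W λ { F uvw@(u₁∈ ∷ v₁∈ ∷ _) →
    side⇒budget F (↭-trans rep (↭-trans (swap _ _ ↭-refl) (prep _ (swap _ _ ↭-refl)))) u₁∈ v₁∈
      (cov F uvw) (s≤s z≤n) }
  ...   | apart _ _ u₂∉′ v₂∉′ = ⊥-elim (<⇒≱ (two-isolated rep isolated-uv isolated-u₁v₁) isolated≤1)
    where
      isolated-uv = isolated-edge rep u∈W v∈W
        (proj₁ (apart-avoids u₁∉ v₁∉) ∷ proj₁ (apart-avoids u₂∉ v₂∉) ∷ [])
      isolated-u₁v₁ = isolated-edge (Represents-swap rep) u₁∈W v₁∈W
        (proj₂ (apart-avoids u₁∉ v₁∉) ∷ proj₁ (apart-avoids u₂∉′ v₂∉′) ∷ [])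

  selectFrom : ∀ L → Represents L → length L ≤ 3 → Selection
  selectFrom [] rep _ with w , w∈W , _ ← ∃∈∧∉ᴸ W [] (≤-trans (s≤s z≤n) 4≤∣W∣) =
    frameThrough w∈W w∈W w∈W λ F _ → all-covered⇒budget F rep []
  selectFrom (e ∷ []) rep _ with kind e (touches-at rep (here refl))
  ... | pendant w w∈W cov =
    frameThrough w∈W w∈W w∈W λ { F (w∈ ∷ _) → all-covered⇒budget F rep (cov F w∈ ∷ []) }
  ... | internal u∈W v∈W =
    frameThrough u∈W v∈W v∈W λ F uvv → all-covered⇒budget F rep (through-edge F uvv ∷ [])
  selectFrom (e₁ ∷ e₂ ∷ []) rep _
    with kind e₁ (touches-at rep (here refl)) | kind e₂ (touches-at rep (there (here refl)))
  ... | internal u∈W v∈W | _ = pairUp rep u∈W v∈W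
  ... | pendant _ _ _ | internal u∈W v∈W = pairUp (Represents-swap rep) u∈W v∈W
  ... | pendant w₁ w₁∈W cov₁ | pendant w₂ w₂∈W cov₂ = frameThrough w₁∈W w₂∈W w₂∈W λ { F (w₁∈ ∷ w₂∈ ∷ _) →
    all-covered⇒budget F rep (cov₁ F w₁∈ ∷ cov₂ F w₂∈ ∷ []) }
  selectFrom (e₁ ∷ e₂ ∷ e₃ ∷ []) rep _
    with kind e₁ (touches-at rep (here refl)) | kind e₂ (touches-at rep (there (here refl)))
       | kind e₃ (touches-at rep (there (there (here refl))))
  ... | internal u∈W v∈W | _ | _ = tripleUp rep u∈W v∈W
  ... | _ | internal u∈W v∈W | _ = tripleUp (Represents-swap rep) u∈W v∈W
  ... | _ | _ | internal u∈W v∈W =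
    tripleUp (↭-trans rep (↭-trans (prep _ (swap _ _ ↭-refl)) (swap _ _ ↭-refl))) u∈W v∈W
  ... | pendant w₁ w₁∈W cov₁ | pendant w₂ w₂∈W cov₂ | pendant w₃ w₃∈W cov₃ =
    frameThrough w₁∈W w₂∈W w₃∈W λ { F (w₁∈ ∷ w₂∈ ∷ w₃∈ ∷ []) →
      all-covered⇒budget F rep (cov₁ F w₁∈ ∷ cov₂ F w₂∈ ∷ cov₃ F w₃∈ ∷ []) }
  selectFrom (_ ∷ _ ∷ _ ∷ _ ∷ _) _ (s≤s (s≤s (s≤s ())))

  select : phi h W ≤ 3 → Selection
  select φ≤3 = selectFrom (filterᵇ (touches W) h) ↭-refl (subst (_≤ 3) (phi≡count-touches h W) φ≤3)

-- The previously chosen cliques V₁, …, Vᵢ only enter through W.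
lemma5p1 : (n : ℕ) (h : History n) (Vs : List (Subset n)) →
    LegalPlay 4 h →
    AllPairs Disjoint Vs →
    All (Clique h) Vs →
    phi h (Wof Vs) ≤ 3 →
    4 ≤ ∣ Wof Vs ∣ →
    isolatedIn h (Wof Vs) ≤ 1 →
    Forces 4 (NextStage (Wof Vs)) 3 h
lemma5p1 n h Vs play _ _ φ≤3 4≤∣W∣ isolated≤1 =
  strategy F 3 h (initial F colourable φ≤3 budget)
  where
    colourable = LegalPlay⇒Colorable play
    loopless : ∀ {u} → ¬ Adj h u u
    loopless uu = Proper⇒≢ (proj₂ colourable) uu refl
    selection = Selection.select 4≤∣W∣ loopless isolated≤1 φ≤3
    F = proj₁ selection
    budget = proj₂ selection
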